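{- Let $n\ge2$ be a natural number and let $\mathbb F_2$ be the free group on generators $\sigma,\tau$. For a reduced word $\alpha$ let $I(\alpha)$ be the set of reduced words in $\mathbb F_2$ beginning with $\alpha$. Define $A_0^\ast:=I(\sigma)$, $B_0^\ast:=I(\sigma^{ -n+1})$, $\gamma_0:=\sigma^{n-1}$; $A_1^\ast:=I(\tau)$, $B_1^\ast:=I(\sigma^{ -n+2}\tau^{ -1})$, $\gamma_1:=\tau\sigma^{n-2}$; and for $2\le i<n$, $A_i^\ast:=I(\sigma^{ -i+1}\tau)$, $B_i^\ast:=I(\sigma^{ -i+2}\tau^{ -1})$, $\gamma_i:=\sigma^{ -i+1}\tau\sigma^{i-2}$. Then for all $i<n$, $\gamma_i(B_i^\ast)=\mathbb F_2-A_i^\ast$ and $\gamma_i^{ -1}(A_i^\ast)=\mathbb F_2-B_i^\ast$.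
   Context: Elements of $\mathbb F_2$ are identified with reduced words in $\sigma^{\pm1},\tau^{\pm1}$; $\sigma^{0}$ is the empty word. For $\gamma\in\mathbb F_2$ and $E\subseteq\mathbb F_2$, $\gamma(E):=\{\gamma\beta:\beta\in E\}$. -}

module Defs where

open import Data.Nat using (ℕ; zero; suc)
open import Data.Bool using (Bool; true; false)
open import Data.List using (List; []; _∷_; _++_; reverse; map; replicate; foldr)
open import Data.Product using (Σ; ∃; _×_; proj₁)
open import Data.Unit using (⊤)
open import Relation.Binary.PropositionalEquality using (_≡_; _≢_)
open import Relation.Nullary using (¬_)
open import Function.Bundles using (_⇔_)

data Letter : Set where
  σ σ⁻ τ τ⁻ : Letter

inv : Letter → Letter
inv σ = σ⁻
inv σ⁻ = σ
inv τ = τ⁻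
inv τ⁻ = τ

Word : Set
Word = List Letter

Reduced : Word → Set
Reduced [] = ⊤
Reduced (x ∷ []) = ⊤
Reduced (x ∷ y ∷ w) = (y ≢ inv x) × Reduced (y ∷ w)

F₂ : Set
F₂ = Σ Word Reduced

cancels : Letter → Letter → Bool
cancels σ σ⁻ = true
cancels σ⁻ σ = true
cancels τ τ⁻ = true
cancels τ⁻ τ = true
cancels _ _ = false

prepend : Letter → Word → Word
prepend x [] = x ∷ []
prepend x (y ∷ w) with cancels x y
... | true = w
... | false = x ∷ y ∷ w

_·_ : Word → Word → Word
u · v = foldr prepend v u

_⁻¹ : Word → Word
w ⁻¹ = reverse (map inv w)

I : Word → Word → Set
I α w = ∃ λ r → w ≡ α ++ r

image : Word → (Word → Set) → Word → Set
image γ E w = ∃ λ (β : F₂) → E (proj₁ β) × (γ · proj₁ β ≡ w)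

_≐_ : (Word → Set) → (Word → Set) → Set
S ≐ T = (w : F₂) → S (proj₁ w) ⇔ T (proj₁ w)

∁ : (Word → Set) → Word → Set
∁ S w = ¬ S w

σ^ σ^- : ℕ → Word
σ^ k = replicate k σ
σ^- k = replicate k σ⁻

-- the data of the lemma, for parameter n and index i
-- (n - 1 etc. are natural subtraction; relevant only when n ≥ 2, i < n)
open import Data.Nat using (_∸_)

A* : ℕ → ℕ → Word
A* n zero = σ ∷ []
A* n (suc zero) = τ ∷ []
A* n (suc (suc k)) = σ^- (suc k) ++ (τ ∷ [])            -- σ^{-i+1} τ, i = k+2

B* : ℕ → ℕ → Word
B* n zero = σ^- (n ∸ 1)
B* n (suc zero) = σ^- (n ∸ 2) ++ (τ⁻ ∷ [])
B* n (suc (suc k)) = σ^- k ++ (τ⁻ ∷ [])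

γ : ℕ → ℕ → Word
γ n zero = σ^ (n ∸ 1)
γ n (suc zero) = τ ∷ σ^ (n ∸ 2)
γ n (suc (suc k)) = σ^- (suc k) ++ (τ ∷ σ^ k)

module Submission where

-- Left multiplication by a letter c sends a reduced word y into the cylinder I(c) exactly when
-- y does not begin with c⁻¹: otherwise c cancels, and since y is reduced what remains cannot
-- begin with c. Left multiplication by a power aᵖ carries I(b) onto I(aᵖ b) as long as b does
-- not cancel against a. Each γᵢ is built from these two moves, which gives
-- γᵢ v ∈ Aᵢ* ⇔ v ∉ Bᵢ* for every reduced v. Both equalities follow, because v ↦ γᵢ v is a
-- bijection of F₂ with inverse v ↦ γᵢ⁻¹ v and membership in a cylinder is decidable.

open import Defs
open import Data.Nat using (ℕ; zero; suc; _≤_; _<_; s≤s)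
open import Data.Product using (_×_; _,_; proj₁; proj₂)
open import Data.List using ([]; _∷_; _++_; reverse; map; replicate; _∷ʳ_)
open import Data.List.Properties
  using (foldr-++; unfold-reverse; reverse-map; reverse-involutive; map-replicate; ++-assoc;
         ∷-injectiveˡ; ∷-injectiveʳ)
open import Data.Bool using (false)
open import Data.Unit using (tt)
open import Data.Empty using (⊥-elim)
open import Relation.Nullary using (¬_; Dec; yes; no)
open import Relation.Nullary.Decidable using (decidable-stable)
open import Relation.Binary.PropositionalEquality
open import Function.Bundles using (_⇔_; mk⇔; Equivalence)
import Function.Properties.Equivalence as ⇔
open import Function.Related.TypeIsomorphisms using (¬-cong-⇔)

open Equivalence

_≟_ : (a b : Letter) → Dec (a ≡ b)
σ  ≟ σ  = yes refl
σ  ≟ σ⁻ = no λ ()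
σ  ≟ τ  = no λ ()
σ  ≟ τ⁻ = no λ ()
σ⁻ ≟ σ  = no λ ()
σ⁻ ≟ σ⁻ = yes refl
σ⁻ ≟ τ  = no λ ()
σ⁻ ≟ τ⁻ = no λ ()
τ  ≟ σ  = no λ ()
τ  ≟ σ⁻ = no λ ()
τ  ≟ τ  = yes refl
τ  ≟ τ⁻ = no λ ()
τ⁻ ≟ σ  = no λ ()
τ⁻ ≟ σ⁻ = no λ ()
τ⁻ ≟ τ  = no λ ()
τ⁻ ≟ τ⁻ = yes refl

inv-involutive : ∀ a → inv (inv a) ≡ a
inv-involutive σ  = refl
inv-involutive σ⁻ = refl
inv-involutive τ  = refl
inv-involutive τ⁻ = refl

inv-irreflexive : ∀ a → a ≢ inv a
inv-irreflexive σ  ()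
inv-irreflexive σ⁻ ()
inv-irreflexive τ  ()
inv-irreflexive τ⁻ ()

cancels-nonInverse : ∀ a b → b ≢ inv a → cancels a b ≡ false
cancels-nonInverse σ  σ  _  = refl
cancels-nonInverse σ  σ⁻ ne = ⊥-elim (ne refl)
cancels-nonInverse σ  τ  _  = refl
cancels-nonInverse σ  τ⁻ _  = refl
cancels-nonInverse σ⁻ σ  ne = ⊥-elim (ne refl)
cancels-nonInverse σ⁻ σ⁻ _  = refl
cancels-nonInverse σ⁻ τ  _  = refl
cancels-nonInverse σ⁻ τ⁻ _  = refl
cancels-nonInverse τ  σ  _  = refl
cancels-nonInverse τ  σ⁻ _  = refl
cancels-nonInverse τ  τ  _  = refl
cancels-nonInverse τ  τ⁻ ne = ⊥-elim (ne refl)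
cancels-nonInverse τ⁻ σ  _  = refl
cancels-nonInverse τ⁻ σ⁻ _  = refl
cancels-nonInverse τ⁻ τ  ne = ⊥-elim (ne refl)
cancels-nonInverse τ⁻ τ⁻ _  = refl

prepend-cancel : ∀ a w → prepend a (inv a ∷ w) ≡ w
prepend-cancel σ  w = refl
prepend-cancel σ⁻ w = refl
prepend-cancel τ  w = refl
prepend-cancel τ⁻ w = refl

prepend-inv-cancel : ∀ a w → prepend (inv a) (a ∷ w) ≡ w
prepend-inv-cancel a w =
  subst (λ b → prepend (inv a) (b ∷ w) ≡ w) (inv-involutive a) (prepend-cancel (inv a) w)

prepend-nonInverse : ∀ a b w → b ≢ inv a → prepend a (b ∷ w) ≡ a ∷ b ∷ w
prepend-nonInverse a b w ne with cancels a b | cancels-nonInverse a b ne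
... | .false | refl = refl

Reduced-tail : ∀ {b} w → Reduced (b ∷ w) → Reduced w
Reduced-tail []      _ = tt
Reduced-tail (_ ∷ _) r = proj₂ r

prepend-reduced : ∀ a w → Reduced w → Reduced (prepend a w)
prepend-reduced a []      _ = tt
prepend-reduced a (b ∷ w) r with b ≟ inv a
... | yes refl rewrite prepend-cancel a w          = Reduced-tail w r
... | no ne    rewrite prepend-nonInverse a b w ne = ne , r

·-reduced : ∀ u w → Reduced w → Reduced (u · w)
·-reduced []      w r = r
·-reduced (a ∷ u) w r = prepend-reduced a (u · w) (·-reduced u w r)

prepend-inverseˡ : ∀ a w → Reduced w → prepend (inv a) (prepend a w) ≡ w
prepend-inverseˡ a [] _ = prepend-inv-cancel a []
prepend-inverseˡ a (b ∷ w) r with b ≟ inv a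
prepend-inverseˡ a (.(inv a) ∷ []) r    | yes refl rewrite prepend-cancel a [] = refl
prepend-inverseˡ a (.(inv a) ∷ c ∷ w) r | yes refl rewrite prepend-cancel a (c ∷ w) =
  prepend-nonInverse (inv a) c w (proj₁ r)
... | no ne rewrite prepend-nonInverse a b w ne = prepend-inv-cancel a (b ∷ w)

·-++ : ∀ u v w → (u ++ v) · w ≡ u · (v · w)
·-++ u v w = foldr-++ prepend w u v

⁻¹-∷ : ∀ a u → (a ∷ u) ⁻¹ ≡ u ⁻¹ ++ inv a ∷ []
⁻¹-∷ a u = unfold-reverse (inv a) (map inv u)

⁻¹-involutive : ∀ u → (u ⁻¹) ⁻¹ ≡ u
⁻¹-involutive u = begin
  reverse (map inv (reverse (map inv u))) ≡⟨ cong reverse (reverse-map inv (map inv u)) ⟩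
  reverse (reverse (map inv (map inv u))) ≡⟨ reverse-involutive _ ⟩
  map inv (map inv u)                     ≡⟨ map-inv-involutive u ⟩
  u                                       ∎
  where
  open ≡-Reasoning
  map-inv-involutive : ∀ u → map inv (map inv u) ≡ u
  map-inv-involutive []      = refl
  map-inv-involutive (a ∷ u) = cong₂ _∷_ (inv-involutive a) (map-inv-involutive u)

·-inverseˡ : ∀ u w → Reduced w → (u ⁻¹) · (u · w) ≡ w
·-inverseˡ []      w r = refl
·-inverseˡ (a ∷ u) w r = begin
  ((a ∷ u) ⁻¹) · ((a ∷ u) · w)
    ≡⟨ cong (_· prepend a (u · w)) (⁻¹-∷ a u) ⟩
  (u ⁻¹ ++ inv a ∷ []) · prepend a (u · w)
    ≡⟨ ·-++ (u ⁻¹) (inv a ∷ []) _ ⟩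
  (u ⁻¹) · prepend (inv a) (prepend a (u · w))
    ≡⟨ cong ((u ⁻¹) ·_) (prepend-inverseˡ a _ (·-reduced u w r)) ⟩
  (u ⁻¹) · (u · w)
    ≡⟨ ·-inverseˡ u w r ⟩
  w ∎
  where open ≡-Reasoning

·-inverseʳ : ∀ u w → Reduced w → u · ((u ⁻¹) · w) ≡ w
·-inverseʳ u w r =
  subst (λ u′ → u′ · ((u ⁻¹) · w) ≡ w) (⁻¹-involutive u) (·-inverseˡ (u ⁻¹) w r)

·-inverseˡ-++ : ∀ u w → (u ⁻¹) · (u ++ w) ≡ w
·-inverseˡ-++ []      w = refl
·-inverseˡ-++ (a ∷ u) w = begin
  ((a ∷ u) ⁻¹) · (a ∷ u ++ w)
    ≡⟨ cong (_· (a ∷ u ++ w)) (⁻¹-∷ a u) ⟩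
  (u ⁻¹ ++ inv a ∷ []) · (a ∷ u ++ w)
    ≡⟨ ·-++ (u ⁻¹) (inv a ∷ []) _ ⟩
  (u ⁻¹) · prepend (inv a) (a ∷ u ++ w)
    ≡⟨ cong ((u ⁻¹) ·_) (prepend-inv-cancel a (u ++ w)) ⟩
  (u ⁻¹) · (u ++ w)
    ≡⟨ ·-inverseˡ-++ u w ⟩
  w ∎
  where open ≡-Reasoning

replicate-∷ʳ : ∀ p (a : Letter) → replicate p a ∷ʳ a ≡ replicate (suc p) a
replicate-∷ʳ zero    a = refl
replicate-∷ʳ (suc p) a = cong (a ∷_) (replicate-∷ʳ p a)

power-inverse : ∀ p a → replicate p a ⁻¹ ≡ replicate p (inv a)
power-inverse p a = begin
  reverse (map inv (replicate p a)) ≡⟨ cong reverse (map-replicate inv p a) ⟩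
  reverse (replicate p (inv a))     ≡⟨ reverse-replicate p ⟩
  replicate p (inv a)               ∎
  where
  open ≡-Reasoning
  reverse-replicate : ∀ p {b : Letter} → reverse (replicate p b) ≡ replicate p b
  reverse-replicate zero        = refl
  reverse-replicate (suc p) {b} = begin
    reverse (b ∷ replicate p b)  ≡⟨ unfold-reverse b (replicate p b) ⟩
    reverse (replicate p b) ∷ʳ b ≡⟨ cong (_∷ʳ b) (reverse-replicate p) ⟩
    replicate p b ∷ʳ b           ≡⟨ replicate-∷ʳ p b ⟩
    replicate (suc p) b          ∎

power-inverseˡ : ∀ p a w → Reduced w → replicate p (inv a) · (replicate p a · w) ≡ w
power-inverseˡ p a w r =
  subst (λ u → u · (replicate p a · w) ≡ w) (power-inverse p a)
        (·-inverseˡ (replicate p a) w r)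

power-·-nonInverse : ∀ p a b w → b ≢ inv a → replicate p a · (b ∷ w) ≡ replicate p a ++ b ∷ w
power-·-nonInverse zero          a b w ne = refl
power-·-nonInverse (suc zero)    a b w ne = prepend-nonInverse a b w ne
power-·-nonInverse (suc (suc p)) a b w ne rewrite power-·-nonInverse (suc p) a b w ne =
  prepend-nonInverse a a (replicate p a ++ b ∷ w) (inv-irreflexive a)

I? : ∀ α w → Dec (I α w)
I? []      w       = yes (w , refl)
I? (a ∷ α) []      = no λ { (_ , ()) }
I? (a ∷ α) (b ∷ w) with a ≟ b | I? α w
... | yes refl | yes (r , eq) = yes (r , cong (a ∷_) eq)
... | yes refl | no ¬α        = no λ { (r , eq) → ¬α (r , ∷-injectiveʳ eq) }
... | no a≢b   | _            = no λ { (_ , eq) → a≢b (sym (∷-injectiveˡ eq)) }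

I-prepend : ∀ a w → Reduced w → I (a ∷ []) (prepend a w) ⇔ (¬ I (inv a ∷ []) w)
I-prepend a [] _ = mk⇔ (λ _ → λ { (_ , ()) }) (λ _ → [] , refl)
I-prepend a (b ∷ w) r with b ≟ inv a
I-prepend a (.(inv a) ∷ w) r | yes refl rewrite prepend-cancel a w =
  mk⇔ (λ aw → ⊥-elim (not-I-a w r aw)) (λ ¬inv-a → ⊥-elim (¬inv-a (w , refl)))
  where
  not-I-a : ∀ w → Reduced (inv a ∷ w) → ¬ I (a ∷ []) w
  not-I-a .(a ∷ _) r (_ , refl) = proj₁ r (sym (inv-involutive a))
... | no ne rewrite prepend-nonInverse a b w ne =
  mk⇔ (λ _ → λ { (_ , eq) → ne (∷-injectiveˡ eq) }) (λ _ → b ∷ w , refl)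

I-power : ∀ p a b w → b ≢ inv a → Reduced w →
          I (replicate p a ++ b ∷ []) (replicate p a · w) ⇔ I (b ∷ []) w
I-power p a b w ne r = mk⇔ to′ from′
  where
  open ≡-Reasoning
  u = replicate p a
  to′ : I (u ++ b ∷ []) (u · w) → I (b ∷ []) w
  to′ (s , eq) = s , (begin
    w                     ≡⟨ ·-inverseˡ u w r ⟨
    (u ⁻¹) · (u · w)      ≡⟨ cong ((u ⁻¹) ·_) (trans eq (++-assoc u (b ∷ []) s)) ⟩
    (u ⁻¹) · (u ++ b ∷ s) ≡⟨ ·-inverseˡ-++ u (b ∷ s) ⟩
    b ∷ s                 ∎)
  from′ : I (b ∷ []) w → I (u ++ b ∷ []) (u · w)
  from′ (s , refl) = s , trans (power-·-nonInverse p a b s ne) (sym (++-assoc u (b ∷ []) s))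

I-prepend-power : ∀ c a p v → inv c ≢ a → Reduced v →
                  I (c ∷ []) (prepend c (replicate p a · v))
                    ⇔ (¬ I (replicate p (inv a) ++ inv c ∷ []) v)
I-prepend-power c a p v ne r =
  ⇔.trans (I-prepend c (replicate p a · v) apv-reduced)
          (¬-cong-⇔ (⇔.sym (subst (λ w → I (replicate p (inv a) ++ inv c ∷ []) w
                                            ⇔ I (inv c ∷ []) (replicate p a · v))
                                   (power-inverseˡ p a v r)
                                   (I-power p (inv a) (inv c) _ ne′ apv-reduced))))
  where
  apv-reduced = ·-reduced (replicate p a) v r
  ne′ : inv c ≢ inv (inv a)
  ne′ rewrite inv-involutive a = ne

image-≐ : ∀ u (E S : Word → Set) → (∀ v → Reduced v → E v ⇔ S (u · v)) → image u E ≐ S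
image-≐ u E S h (w , r) = mk⇔ to′ from′
  where
  v = (u ⁻¹) · w
  v-reduced = ·-reduced (u ⁻¹) w r
  to′ : image u E w → S w
  to′ ((β , rβ) , eβ , eq) = subst S eq (to (h β rβ) eβ)
  from′ : S w → image u E w
  from′ s = (v , v-reduced) ,
            from (h v v-reduced) (subst S (sym (·-inverseʳ u w r)) s) ,
            ·-inverseʳ u w r

image-∁ : ∀ u (E S : Word → Set) → (∀ w → Dec (E w)) →
          (∀ v → Reduced v → S (u · v) ⇔ (¬ E v)) → image u E ≐ ∁ S
image-∁ u E S E? h = image-≐ u E (∁ S) λ v r →
  mk⇔ (λ e s → to (h v r) s e)
      (λ ¬s → decidable-stable (E? v) λ ¬e → ¬s (from (h v r) ¬e))

image-⁻¹-∁ : ∀ u (E S : Word → Set) →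
             (∀ v → Reduced v → S (u · v) ⇔ (¬ E v)) → image (u ⁻¹) S ≐ ∁ E
image-⁻¹-∁ u E S h = image-≐ (u ⁻¹) S (∁ E) λ v r →
  subst (λ w → S w ⇔ (¬ E ((u ⁻¹) · v))) (·-inverseʳ u v r)
        (h ((u ⁻¹) · v) (·-reduced (u ⁻¹) v r))

γ-flips : ∀ n → 2 ≤ n → ∀ i v → Reduced v → I (A* n i) (γ n i · v) ⇔ (¬ I (B* n i) v)
γ-flips (suc (suc p)) _ zero v r =
  subst (λ β → I (σ ∷ []) (σ^ (suc p) · v) ⇔ (¬ I β v)) (replicate-∷ʳ p σ⁻)
        (I-prepend-power σ σ p v (λ ()) r)
γ-flips (suc (suc p)) _ (suc zero) v r = I-prepend-power τ σ p v (λ ()) r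
γ-flips (suc zero) (s≤s ()) zero v r
γ-flips (suc zero) (s≤s ()) (suc zero) v r
γ-flips n _ (suc (suc k)) v r =
  subst (λ w → I (A* n (suc (suc k))) w ⇔ (¬ I (B* n (suc (suc k))) v))
        (sym (·-++ (σ^- (suc k)) (τ ∷ σ^ k) v))
        (⇔.trans (I-power (suc k) σ⁻ τ _ (λ ()) τσᵏv-reduced)
                 (I-prepend-power τ σ k v (λ ()) r))
  where τσᵏv-reduced = prepend-reduced τ _ (·-reduced (σ^ k) v r)

-- For i ≥ 2 the data do not depend on n.
lemma2p3 : (n : ℕ) → 2 ≤ n → (i : ℕ) → i < n →
    (image (γ n i) (I (B* n i)) ≐ ∁ (I (A* n i)))
    × (image (γ n i ⁻¹) (I (A* n i)) ≐ ∁ (I (B* n i)))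
lemma2p3 n 2≤n i _ =
  image-∁ (γ n i) (I (B* n i)) (I (A* n i)) (I? (B* n i)) (γ-flips n 2≤n i) ,
  image-⁻¹-∁ (γ n i) (I (B* n i)) (I (A* n i)) (γ-flips n 2≤n i)
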